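{- A digraph $D=(V,A)$ is antistrong if and only if the cycle matroid $M(B(D))$ of its bipartite representation has rank $2|V|-1$.
   Context: Digraphs are finite and loopless. In a walk (in the underlying graph) an arc $vw$ is forward if traversed from $v$ to $w$ and backward if traversed from $w$ to $v$. An antidirected trail is a walk with no repeated arc whose arcs alternate between forward and backward; it is a forward antidirected trail if it begins and ends with a forward arc. A digraph is antistrong if it has at least three vertices and contains a forward antidirected $(x,y)$-trail for every pair of distinct vertices $x,y$. The bipartite representation of $D=(V,A)$ is the bipartite graph $B(D)$ with vertex set $V'\cup V''$ (two disjoint copies $V'=\{v'\}$, $V''=\{v''\}$ of $V$) and edge set $\{v'w'':vw\in A\}$. The cycle matroid of a graph has the edge set as ground set and the edge sets of forests as independent sets. -}

module Defs where

open import Data.Nat using (ℕ; _≤_; _+_; _*_)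
open import Data.Bool using (Bool; true; false)
open import Data.Fin using (Fin)
open import Data.List using (List; []; _∷_; length; map; filterᵇ; cartesianProduct; allFin)
open import Data.List.Membership.Propositional using (_∈_)
open import Data.List.Relation.Unary.Unique.Propositional using (Unique)
open import Data.List.Relation.Binary.Sublist.Propositional using (_⊆_)
open import Data.Product using (Σ; _×_; _,_; ∃; proj₁; proj₂)
open import Data.Sum using (_⊎_; inj₁; inj₂)
open import Relation.Nullary using (¬_)
open import Relation.Binary.PropositionalEquality using (_≡_; _≢_)

-- Digraphs: finite vertex set Fin n, arc relation given by a Boolean
-- adjacency function (so no parallel arcs), loopless.

record Digraph : Set where
  field
    n        : ℕ
    arc      : Fin n → Fin n → Bool
    loopless : ∀ v → arc v v ≡ false

open Digraph public

Arc : (D : Digraph) → Fin (n D) → Fin (n D) → Set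
Arc D v w = arc D v w ≡ true

-- AW D s e x y as : an antidirected walk from x to y
-- whose list of traversed arcs (as ordered pairs (tail , head)) is as.
-- s = true  : the first arc is traversed forward,
-- s = false : the first arc is traversed backward;
-- e is the direction the *next* arc would have to take after the walk
-- ends (so the last arc is forward iff e ≡ false).

data AW (D : Digraph) : Bool → Bool → Fin (n D) → Fin (n D)
        → List (Fin (n D) × Fin (n D)) → Set where
  nil : ∀ {b x} → AW D b b x x []
  fwd : ∀ {e x z y as} → Arc D x z → AW D false e z y as
        → AW D true e x y ((x , z) ∷ as)
  bwd : ∀ {e x z y as} → Arc D z x → AW D true e z y as
        → AW D false e x y ((z , x) ∷ as)

ForwardAntidirectedTrail : (D : Digraph) → Fin (n D) → Fin (n D) → Set
ForwardAntidirectedTrail D x y =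
  Σ (List (Fin (n D) × Fin (n D))) λ as → AW D true false x y as × Unique as

Antistrong : Digraph → Set
Antistrong D = (3 ≤ n D) ×
  (∀ (x y : Fin (n D)) → x ≢ y → ForwardAntidirectedTrail D x y)

-- Finite simple graphs given by a vertex type and a list of edges
-- (each edge {u,v} stored once as an ordered pair (u , v)).

record Graph : Set₁ where
  field
    V     : Set
    edges : List (V × V)

open Graph public

Adj : {V : Set} → List (V × V) → V → V → Set
Adj F u v = ((u , v) ∈ F) ⊎ ((v , u) ∈ F)

data CycAdj {V : Set} (F : List (V × V)) (f : V) : List V → Set where
  last : ∀ {u} → Adj F u f → CycAdj F f (u ∷ [])
  step : ∀ {u w vs} → Adj F u w → CycAdj F f (w ∷ vs) → CycAdj F f (u ∷ w ∷ vs)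

HasCycle : {V : Set} → List (V × V) → Set
HasCycle {V} F = Σ (List V) λ vs → (3 ≤ length vs) × Unique vs ×
  (Σ V λ f → Σ (List V) λ rest → (vs ≡ f ∷ rest) × CycAdj F f vs)

IsForest : {V : Set} → List (V × V) → Set
IsForest F = ¬ HasCycle F

Independent : (G : Graph) → List (V G × V G) → Set
Independent G F = (F ⊆ edges G) × IsForest F

CycleMatroidRank : Graph → ℕ → Set
CycleMatroidRank G r =
  (Σ (List (V G × V G)) λ F → Independent G F × length F ≡ r) ×
  (∀ F → Independent G F → length F ≤ r)

-- Bipartite representation B(D): vertex set V' ∪ V'' (inj₁ v = v',
-- inj₂ v = v''), edges v'w'' for each arc vw of D.

arcList : (D : Digraph) → List (Fin (n D) × Fin (n D))
arcList D = filterᵇ (λ p → arc D (proj₁ p) (proj₂ p))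
                    (cartesianProduct (allFin (n D)) (allFin (n D)))

B : Digraph → Graph
B D = record
  { V     = Fin (n D) ⊎ Fin (n D)
  ; edges = map (λ p → (inj₁ (proj₁ p) , inj₂ (proj₂ p))) (arcList D)
  }

module Submission where

-- Every forest F on a vertex set V satisfies |F| + c(F) = |V|, and a spanning forest of G
-- has the components of G, so M(G) has rank |V| − c(G); as B(D) has 2n vertices, the rank
-- is 2n − 1 exactly when B(D) is connected. An antidirected walk of D is a walk of B(D)
-- alternating between V′ and V″, a forward one running from x′ to y″, and a path of B(D)
-- without repeated vertices reads back as a trail. So if D is antistrong then B(D) is
-- connected (x′ and c′ are joined through z″ for any third vertex z), and if B(D) is
-- connected then every x′ reaches every y″ by a trail. Connectivity also forces n ≥ 3:
-- for n ≤ 2 the looplessness of D separates x′ from x″.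

open import Defs
open import Data.Bool using (Bool; true; false; T)
open import Data.Bool.Properties using (T-≡)
open import Data.Empty using (⊥-elim)
open import Data.Fin using (Fin; zero; suc; fromℕ<)
import Data.Fin.Properties as Fin
open import Data.List using (List; []; _∷_; length; map; _++_; cartesianProduct; allFin)
open import Data.List.Membership.Propositional using (_∈_; _∉_)
open import Data.List.Membership.Propositional.Properties
  using (∈-map⁺; ∈-map⁻; ∈-filter⁺; ∈-filter⁻; ∈-cartesianProduct⁺; ∈-allFin; ∈-++⁺ˡ; ∈-++⁺ʳ)
open import Data.List.Properties using (length-map; length-++; length-tabulate; length-removeAt′)
open import Data.List.Relation.Binary.Sublist.Propositional using (_⊆_; []; _∷_; _∷ʳ_; ⊆-refl; lookup)
open import Data.List.Relation.Binary.Sublist.Propositional.Properties using (All-resp-⊆)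
open import Data.List.Relation.Unary.All using ([]; _∷_)
open import Data.List.Relation.Unary.All.Properties using (¬Any⇒All¬; All¬⇒¬Any)
open import Data.List.Relation.Unary.Any using (here; there; _─_)
open import Data.List.Relation.Unary.Unique.Propositional using (Unique; []; _∷_)
import Data.List.Relation.Unary.Unique.Propositional.Properties as Unique
open import Data.Nat using (ℕ; zero; suc; _+_; _*_; _≤_; z≤n; s≤s; s≤s⁻¹; _≤?_)
open import Data.Nat.Properties using (+-comm; +-suc; +-identityʳ; +-monoʳ-≤; +-cancelˡ-≡; +-cancelʳ-≤; ≤-antisym; ≤-trans; ≰⇒>)
open import Data.Product using (Σ; ∃; ∃₂; _×_; _,_; proj₁; proj₂)
open import Data.Sum using (_⊎_; inj₁; inj₂; reduce)
open import Data.Sum.Properties using (≡-dec)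
open import Function using (_∘_)
open import Function.Bundles using (_⇔_; mk⇔; Equivalence)
open import Relation.Binary.Construct.Closure.ReflexiveTransitive using (Star; ε; _◅_; _◅◅_; fold; reverse)
import Relation.Binary.Construct.Closure.ReflexiveTransitive as Star
open import Relation.Binary.Definitions using (DecidableEquality)
open import Relation.Binary.PropositionalEquality using (_≡_; _≢_; refl; sym; trans; cong; cong₂; subst; module ≡-Reasoning)
open import Relation.Nullary using (¬_; Dec; yes; no)
open import Relation.Nullary.Decidable using (T?)

module _ {A : Set} where

  Unique-resp-⊇ : ∀ {xs ys : List A} → xs ⊆ ys → Unique ys → Unique xs
  Unique-resp-⊇ []         u        = u
  Unique-resp-⊇ (y ∷ʳ τ)   (_ ∷ u)  = Unique-resp-⊇ τ u
  Unique-resp-⊇ (refl ∷ τ) (x∉ ∷ u) = All-resp-⊆ τ x∉ ∷ Unique-resp-⊇ τ u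

  xs⊆x∷xs : ∀ {x} {xs : List A} → xs ⊆ x ∷ xs
  xs⊆x∷xs = _ ∷ʳ ⊆-refl

  ─-⊆ : ∀ {x} {xs : List A} (x∈ : x ∈ xs) → (xs ─ x∈) ⊆ xs
  ─-⊆ (here _)   = xs⊆x∷xs
  ─-⊆ (there x∈) = refl ∷ ─-⊆ x∈

  ∈-─⁺ : ∀ {x y} {xs : List A} (x∈ : x ∈ xs) → y ∈ xs → y ≢ x → y ∈ (xs ─ x∈)
  ∈-─⁺ (here refl) (here refl) y≢x = ⊥-elim (y≢x refl)
  ∈-─⁺ (here refl) (there y∈)  _   = y∈
  ∈-─⁺ (there x∈)  (here refl) _   = here refl
  ∈-─⁺ (there x∈)  (there y∈)  y≢x = there (∈-─⁺ x∈ y∈ y≢x)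

  ∈-─-≢ : ∀ {x y} {xs : List A} (x∈ : x ∈ xs) → Unique xs → y ∈ (xs ─ x∈) → y ≢ x
  ∈-─-≢ (here refl) (x∉ ∷ _) y∈          refl = All¬⇒¬Any x∉ y∈
  ∈-─-≢ (there x∈)  (y∉ ∷ _) (here refl) refl = All¬⇒¬Any y∉ x∈
  ∈-─-≢ (there x∈)  (_ ∷ u)  (there y∈)       = ∈-─-≢ x∈ u y∈

  length-─′ : ∀ {x} {xs : List A} (x∈ : x ∈ xs) → length xs ≡ suc (length (xs ─ x∈))
  length-─′ {xs = xs} x∈ = length-removeAt′ xs _

  Unique-constant⇒length≤1 : ∀ {xs : List A} {c} → Unique xs → (∀ {x} → x ∈ xs → x ≡ c) → length xs ≤ 1
  Unique-constant⇒length≤1 {[]}         _               _     = z≤n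
  Unique-constant⇒length≤1 {_ ∷ []}     _               _     = s≤s z≤n
  Unique-constant⇒length≤1 {_ ∷ _ ∷ _}  ((x≢y ∷ _) ∷ _) all-c =
    ⊥-elim (x≢y (trans (all-c (here refl)) (sym (all-c (there (here refl))))))

  length≡1⇒∈-≡ : ∀ {xs : List A} {x y} → length xs ≡ 1 → x ∈ xs → y ∈ xs → x ≡ y
  length≡1⇒∈-≡ {_ ∷ []} _ (here refl) (here refl) = refl

module _ {V : Set} where

  Connected : List (V × V) → V → V → Set
  Connected F = Star (Adj F)

  Adj-sym : ∀ {F : List (V × V)} {u w} → Adj F u w → Adj F w u
  Adj-sym (inj₁ uw) = inj₂ uw
  Adj-sym (inj₂ wu) = inj₁ wu

  Adj-mono : ∀ {F G : List (V × V)} → F ⊆ G → ∀ {u w} → Adj F u w → Adj G u w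
  Adj-mono τ (inj₁ uw) = inj₁ (lookup τ uw)
  Adj-mono τ (inj₂ wu) = inj₂ (lookup τ wu)

  Connected-sym : ∀ {F : List (V × V)} {u w} → Connected F u w → Connected F w u
  Connected-sym = reverse Adj-sym

  Connected-mono : ∀ {F G : List (V × V)} → F ⊆ G → ∀ {u w} → Connected F u w → Connected G u w
  Connected-mono τ = Star.map (Adj-mono τ)

  _Respects-edges_ : {L : Set} → (V → L) → List (V × V) → Set
  ℓ Respects-edges F = ∀ {u w} → (u , w) ∈ F → ℓ u ≡ ℓ w

  Adj-resp : ∀ {L : Set} {ℓ : V → L} {F} → ℓ Respects-edges F → ∀ {u w} → Adj F u w → ℓ u ≡ ℓ w
  Adj-resp resp (inj₁ uw) = resp uw
  Adj-resp resp (inj₂ wu) = sym (resp wu)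

  Connected-resp : ∀ {L : Set} {ℓ : V → L} {F} → ℓ Respects-edges F → ∀ {u w} → Connected F u w → ℓ u ≡ ℓ w
  Connected-resp {ℓ = ℓ} resp = fold (λ u w → ℓ u ≡ ℓ w) (trans ∘ Adj-resp resp) refl

  data Path (F : List (V × V)) : V → V → List V → Set where
    []  : ∀ {u} → Path F u u (u ∷ [])
    _∷_ : ∀ {u w x vs} → Adj F u w → Path F w x vs → Path F u x (u ∷ vs)

  module _ {F : List (V × V)} where

    Path-head∈ : ∀ {u w vs} → Path F u w vs → u ∈ vs
    Path-head∈ []      = here refl
    Path-head∈ (_ ∷ _) = here refl

    Path-length : ∀ {u w vs} → Path F u w vs → 1 ≤ length vs
    Path-length []      = s≤s z≤n
    Path-length (_ ∷ _) = s≤s z≤n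

    Path-last∈ : ∀ {u w vs} → Path F u w vs → w ∈ vs
    Path-last∈ []      = here refl
    Path-last∈ (_ ∷ p) = there (Path-last∈ p)

    Path⇒Connected : ∀ {u w vs} → Path F u w vs → Connected F u w
    Path⇒Connected []      = ε
    Path⇒Connected (a ∷ p) = a ◅ Path⇒Connected p

    closed-Path-trivial : ∀ {u vs} → Path F u u (u ∷ vs) → Unique (u ∷ vs) → vs ≡ []
    closed-Path-trivial []      _        = refl
    closed-Path-trivial (_ ∷ p) (u∉ ∷ _) = ⊥-elim (All¬⇒¬Any u∉ (Path-last∈ p))

    CycAdj⇒Path : ∀ {f u vs} → CycAdj F f (u ∷ vs) → ∃ λ l → Path F u l (u ∷ vs) × Adj F l f
    CycAdj⇒Path (last lf) = _ , [] , lf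
    CycAdj⇒Path (step a c) with CycAdj⇒Path c
    ... | l , p , lf = l , a ∷ p , lf

    Path⇒CycAdj : ∀ {f u l vs} → Path F u l (u ∷ vs) → Adj F l f → CycAdj F f (u ∷ vs)
    Path⇒CycAdj []                lf = last lf
    Path⇒CycAdj (a ∷ p@[])        lf = step a (Path⇒CycAdj p lf)
    Path⇒CycAdj (a ∷ p@(_ ∷ _))   lf = step a (Path⇒CycAdj p lf)

    module _ (_≟_ : DecidableEquality V) where
      open import Data.List.Membership.DecPropositional _≟_ using (_∈?_)

      suffix-Path : ∀ {u v w vs} → Path F v w vs → u ∈ vs → Unique vs → ∃ λ us → Path F u w us × Unique us
      suffix-Path []      (here refl) U       = _ , [] , U
      suffix-Path (a ∷ p) (here refl) U       = _ , a ∷ p , U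
      suffix-Path (_ ∷ p) (there u∈)  (_ ∷ U) = suffix-Path p u∈ U

      Connected⇒Path : ∀ {u w} → Connected F u w → ∃ λ vs → Path F u w vs × Unique vs
      Connected⇒Path ε = _ , [] , [] ∷ []
      Connected⇒Path {u} (a ◅ c) with Connected⇒Path c
      ... | vs , p , U with u ∈? vs
      ...   | yes u∈ = suffix-Path p u∈ U
      ...   | no u∉  = _ , a ∷ p , ¬Any⇒All¬ vs u∉ ∷ U

  Path-mono : ∀ {F G : List (V × V)} → F ⊆ G → ∀ {u w vs} → Path F u w vs → Path G u w vs
  Path-mono τ []      = []
  Path-mono τ (a ∷ p) = Adj-mono τ a ∷ Path-mono τ p

  CycAdj-mono : ∀ {F G : List (V × V)} → F ⊆ G → ∀ {f vs} → CycAdj F f vs → CycAdj G f vs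
  CycAdj-mono τ (last a)   = last (Adj-mono τ a)
  CycAdj-mono τ (step a c) = step (Adj-mono τ a) (CycAdj-mono τ c)

  HasCycle-mono : ∀ {F G : List (V × V)} → F ⊆ G → HasCycle F → HasCycle G
  HasCycle-mono τ (vs , 3≤ , U , f , rest , eq , c) = vs , 3≤ , U , f , rest , eq , CycAdj-mono τ c

  []-forest : IsForest {V} []
  []-forest (_ , _ , _ , _ , _ , _ , last (inj₁ ()))
  []-forest (_ , _ , _ , _ , _ , _ , last (inj₂ ()))
  []-forest (_ , _ , _ , _ , _ , _ , step (inj₁ ()) _)
  []-forest (_ , _ , _ , _ , _ , _ , step (inj₂ ()) _)

  -- HasCycle only sees cycles through three distinct vertices, so repeated edges (and
  -- loops) must be excluded separately.
  Simple : List (V × V) → Set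
  Simple F = Unique F × (∀ {u w} → (u , w) ∈ F → (w , u) ∉ F)

  Simple-resp-⊇ : ∀ {F G : List (V × V)} → F ⊆ G → Simple G → Simple F
  Simple-resp-⊇ τ (U , asym) = Unique-resp-⊇ τ U , λ uw wu → asym (lookup τ uw) (lookup τ wu)

  cycle-through-new-edge : DecidableEquality V → ∀ {F a b} → Simple ((a , b) ∷ F) → Connected F a b →
                           HasCycle ((a , b) ∷ F)
  cycle-through-new-edge _≟_ (ab∉F ∷ _ , asym) ab with Connected⇒Path _≟_ ab
  ... | _ , []                 , _ = ⊥-elim (asym (here refl) (here refl))
  ... | _ , inj₁ ab∈F ∷ []     , _ = ⊥-elim (All¬⇒¬Any ab∉F ab∈F)
  ... | _ , inj₂ ba∈F ∷ []     , _ = ⊥-elim (asym (here refl) (there ba∈F))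
  ... | _ , aw ∷ wx ∷ p        , U =
    _ , s≤s (s≤s (Path-length p)) , U , _ , _ , refl ,
    Path⇒CycAdj (Path-mono xs⊆x∷xs (aw ∷ wx ∷ p)) (inj₂ (here refl))

  -- A cycle of (a , b) ∷ T either lies in T or uses the edge ab exactly once, the rest of
  -- it being a T-path between a and b, which ℓ a ≢ ℓ b forbids.
  module JoinForest {L : Set} {T : List (V × V)} (ℓ : V → L) (resp : ℓ Respects-edges T)
                    {a b : V} (ℓa≢ℓb : ℓ a ≢ ℓ b) where

    private
      Link : V → V → Set
      Link u v = (u , v) ≡ (a , b) ⊎ (v , u) ≡ (a , b)

      link-sym : ∀ {u v} → Link u v → Link v u
      link-sym (inj₁ e) = inj₂ e
      link-sym (inj₂ e) = inj₁ e

      link-separates : ∀ {u v} → Link u v → ℓ u ≢ ℓ v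
      link-separates (inj₁ refl) = ℓa≢ℓb
      link-separates (inj₂ refl) = ℓa≢ℓb ∘ sym

      link-partner : ∀ {u v w} → Link u v → Link u w → v ≡ w
      link-partner (inj₁ refl) (inj₁ refl) = refl
      link-partner (inj₁ refl) (inj₂ refl) = refl
      link-partner (inj₂ refl) (inj₁ refl) = refl
      link-partner (inj₂ refl) (inj₂ refl) = refl

      F : List (V × V)
      F = (a , b) ∷ T

      split : ∀ {u v} → Adj F u v → Adj T u v ⊎ Link u v
      split (inj₁ (here e))   = inj₂ (inj₁ e)
      split (inj₁ (there uv)) = inj₁ (inj₁ uv)
      split (inj₂ (here e))   = inj₂ (inj₂ e)
      split (inj₂ (there vu)) = inj₁ (inj₂ vu)

      Path-resp : ∀ {u w vs} → Path T u w vs → ℓ u ≡ ℓ w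
      Path-resp = Connected-resp resp ∘ Path⇒Connected

      Crossing : V → V → List V → Set
      Crossing u w vs = (a ∈ vs × b ∈ vs) × ℓ u ≢ ℓ w

      link-ends∈ : ∀ {u v vs} → Link u v → u ∈ vs → v ∈ vs → a ∈ vs × b ∈ vs
      link-ends∈ (inj₁ refl) u∈ v∈ = u∈ , v∈
      link-ends∈ (inj₂ refl) u∈ v∈ = v∈ , u∈

      link-end∈ : ∀ {u v vs} → Link u v → a ∈ vs → b ∈ vs → u ∈ vs
      link-end∈ (inj₁ refl) a∈ b∈ = a∈
      link-end∈ (inj₂ refl) a∈ b∈ = b∈

      path-split : ∀ {u w vs} → Path F u w vs → Unique vs → Path T u w vs ⊎ Crossing u w vs
      path-split []      _        = inj₁ []
      path-split (e ∷ p) (u∉ ∷ U) with split e | path-split p U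
      ... | inj₁ t | inj₁ q                = inj₁ (t ∷ q)
      ... | inj₁ t | inj₂ ((a∈ , b∈) , ℓ≢) = inj₂ ((there a∈ , there b∈) , ℓ≢ ∘ trans (sym (Adj-resp resp t)))
      ... | inj₂ k | inj₁ q                =
        inj₂ (link-ends∈ k (here refl) (there (Path-head∈ q)) , λ eq → link-separates k (trans eq (sym (Path-resp q))))
      ... | inj₂ k | inj₂ ((a∈ , b∈) , _)  = ⊥-elim (All¬⇒¬Any u∉ (link-end∈ k a∈ b∈))

    join-forest : IsForest T → IsForest ((a , b) ∷ T)
    join-forest _ (_ , s≤s () , _ , _ , [] , refl , _)
    join-forest forest (_ , 3≤ , U@(f∉ ∷ U′) , f , v₂ ∷ rest , refl , step first cyc)
      with CycAdj⇒Path cyc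
    ... | l , p , close with split first | split close | path-split p U′
    ... | inj₁ t₁ | inj₁ t₂ | inj₁ q        = forest (_ , 3≤ , U , f , _ , refl , Path⇒CycAdj (t₁ ∷ q) t₂)
    ... | inj₁ t₁ | inj₁ t₂ | inj₂ (_ , ℓ≢) = ℓ≢ (trans (sym (Adj-resp resp t₁)) (sym (Adj-resp resp t₂)))
    ... | inj₂ k₁ | _       | inj₂ ((a∈ , b∈) , _) = All¬⇒¬Any f∉ (link-end∈ k₁ a∈ b∈)
    ... | _       | inj₂ k₂ | inj₂ ((a∈ , b∈) , _) = All¬⇒¬Any f∉ (link-end∈ (link-sym k₂) a∈ b∈)
    ... | inj₂ k₁ | inj₁ t₂ | inj₁ q =
      link-separates k₁ (trans (sym (Adj-resp resp t₂)) (sym (Path-resp q)))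
    ... | inj₁ t₁ | inj₂ k₂ | inj₁ q =
      link-separates k₂ (trans (sym (Path-resp q)) (sym (Adj-resp resp t₁)))
    ... | inj₂ k₁ | inj₂ k₂ | inj₁ q with link-partner k₁ (link-sym k₂)
    ...   | refl with closed-Path-trivial p U′ | 3≤
    ...     | refl | s≤s (s≤s ())

module Components {V : Set} (_≟_ : DecidableEquality V)
                  {vs : List V} (vs-unique : Unique vs) (vs-complete : ∀ v → v ∈ vs) where

  -- `root` picks one vertex in each component of T, so `edges+roots` says |T| + c(T) = |V|.
  record Labelling (T : List (V × V)) : Set where
    field
      roots          : List V
      root           : V → V
      root∈roots     : ∀ v → root v ∈ roots
      root-connected : ∀ v → Connected T v (root v)
      root-of-root   : ∀ {r} → r ∈ roots → root r ≡ r
      root-resp      : root Respects-edges T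
      roots-unique   : Unique roots
      edges+roots    : length T + length roots ≡ length vs

  open Labelling

  discrete : Labelling []
  discrete = record
    { roots          = vs
    ; root           = λ v → v
    ; root∈roots     = vs-complete
    ; root-connected = λ _ → ε
    ; root-of-root   = λ _ → refl
    ; root-resp      = λ ()
    ; roots-unique   = vs-unique
    ; edges+roots    = refl
    }

  same-root⇒connected : ∀ {T} (L : Labelling T) {u w} → root L u ≡ root L w → Connected T u w
  same-root⇒connected {T} L {u} {w} eq =
    root-connected L u ◅◅ subst (λ r → Connected T r w) (sym eq) (Connected-sym (root-connected L w))

  module _ {T} (L : Labelling T) {a b : V} (diff : root L a ≢ root L b) where

    private
      rb∈ : root L b ∈ roots L
      rb∈ = root∈roots L b

      redirect : V → V
      redirect x with x ≟ root L b
      ... | yes _ = root L a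
      ... | no  _ = x

      redirect-rb : redirect (root L b) ≡ root L a
      redirect-rb with root L b ≟ root L b
      ... | yes _ = refl
      ... | no rb≢rb = ⊥-elim (rb≢rb refl)

      redirect-other : ∀ {x} → x ≢ root L b → redirect x ≡ x
      redirect-other {x} x≢rb with x ≟ root L b
      ... | yes x≡rb = ⊥-elim (x≢rb x≡rb)
      ... | no  _    = refl

      redirect∈roots : ∀ v → redirect (root L v) ∈ (roots L ─ rb∈)
      redirect∈roots v with root L v ≟ root L b
      ... | yes _   = ∈-─⁺ rb∈ (root∈roots L a) diff
      ... | no rv≢rb = ∈-─⁺ rb∈ (root∈roots L v) rv≢rb

      connected-to-redirect : ∀ v → Connected ((a , b) ∷ T) v (redirect (root L v))
      connected-to-redirect v with root L v ≟ root L b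
      ... | yes rv≡rb = Connected-mono xs⊆x∷xs (same-root⇒connected L rv≡rb)
                        ◅◅ inj₂ (here refl) ◅ Connected-mono xs⊆x∷xs (root-connected L a)
      ... | no _      = Connected-mono xs⊆x∷xs (root-connected L v)

      redirect-fixes-roots : ∀ {r} → r ∈ (roots L ─ rb∈) → redirect (root L r) ≡ r
      redirect-fixes-roots r∈ = trans (cong redirect (root-of-root L (lookup (─-⊆ rb∈) r∈)))
                                      (redirect-other (∈-─-≢ rb∈ (roots-unique L) r∈))

      redirect-resp : (redirect ∘ root L) Respects-edges ((a , b) ∷ T)
      redirect-resp (here refl) = trans (redirect-other diff) (sym redirect-rb)
      redirect-resp (there uw)  = cong redirect (root-resp L uw)

      count : suc (length T) + length (roots L ─ rb∈) ≡ length vs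
      count = begin
        suc (length T) + length (roots L ─ rb∈)   ≡⟨ sym (+-suc (length T) _) ⟩
        length T + suc (length (roots L ─ rb∈))   ≡⟨ cong (length T +_) (sym (length-─′ rb∈)) ⟩
        length T + length (roots L)               ≡⟨ edges+roots L ⟩
        length vs                                 ∎
        where open ≡-Reasoning

    join : Labelling ((a , b) ∷ T)
    join = record
      { roots          = roots L ─ rb∈
      ; root           = redirect ∘ root L
      ; root∈roots     = redirect∈roots
      ; root-connected = connected-to-redirect
      ; root-of-root   = redirect-fixes-roots
      ; root-resp      = redirect-resp
      ; roots-unique   = Unique-resp-⊇ (─-⊆ rb∈) (roots-unique L)
      ; edges+roots    = count
      }

    join-coarsens : ∀ {u w} → root L u ≡ root L w → root join u ≡ root join w
    join-coarsens = cong redirect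

  forest-labelling : ∀ F → Simple F → IsForest F → Labelling F
  forest-labelling []            _      _      = discrete
  forest-labelling ((a , b) ∷ F) simple forest
    with forest-labelling F (Simple-resp-⊇ xs⊆x∷xs simple) (forest ∘ HasCycle-mono xs⊆x∷xs)
  ... | L with root L a ≟ root L b
  ...   | yes same = ⊥-elim (forest (cycle-through-new-edge _≟_ simple (same-root⇒connected L same)))
  ...   | no  diff = join L diff

  record SpanningForest (G : List (V × V)) : Set where
    field
      forest    : List (V × V)
      forest⊆   : forest ⊆ G
      acyclic   : IsForest forest
      labelling : Labelling forest
      spans     : root labelling Respects-edges G

    connects : ∀ {u w} → Connected G u w → Connected forest u w
    connects = same-root⇒connected labelling ∘ Connected-resp spans

  open SpanningForest

  spanning-forest : ∀ G → SpanningForest G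
  spanning-forest []            = record
    { forest = [] ; forest⊆ = [] ; acyclic = []-forest ; labelling = discrete ; spans = λ () }
  spanning-forest ((a , b) ∷ G) with spanning-forest G
  ... | S with root (labelling S) a ≟ root (labelling S) b
  ...   | yes same = record
    { forest    = forest S
    ; forest⊆   = _ ∷ʳ forest⊆ S
    ; acyclic   = acyclic S
    ; labelling = labelling S
    ; spans     = λ { (here refl) → same ; (there uw) → spans S uw }
    }
  ...   | no diff = record
    { forest    = (a , b) ∷ forest S
    ; forest⊆   = refl ∷ forest⊆ S
    ; acyclic   = JoinForest.join-forest (root L) (root-resp L) diff (acyclic S)
    ; labelling = join L diff
    ; spans     = λ { (here refl) → root-resp (join L diff) (here refl)
                    ; (there uw)  → join-coarsens L diff (spans S uw) }
    }
    where L = labelling S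

  module _ {T} (L : Labelling T) where

    roots-nonempty : V → 1 ≤ length (roots L)
    roots-nonempty v with roots L | root∈roots L v
    ... | _ ∷ _ | _ = s≤s z≤n

    edges+1≤vertices : V → length T + 1 ≤ length vs
    edges+1≤vertices v = subst (length T + 1 ≤_) (edges+roots L) (+-monoʳ-≤ (length T) (roots-nonempty v))

    connected⇒edges+1≡vertices : V → (∀ u w → Connected T u w) → length T + 1 ≡ length vs
    connected⇒edges+1≡vertices v connected = trans (cong (length T +_) (sym one-root)) (edges+roots L)
      where
      one-root : length (roots L) ≡ 1
      one-root = ≤-antisym
        (Unique-constant⇒length≤1 (roots-unique L) λ {r} r∈ → trans (sym (root-of-root L r∈)) (Connected-resp (root-resp L) (connected r v)))
        (roots-nonempty v)

    edges+1≡vertices⇒connected : length T + 1 ≡ length vs → ∀ u w → Connected T u w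
    edges+1≡vertices⇒connected tight u w =
      same-root⇒connected L (length≡1⇒∈-≡ one-root (root∈roots L u) (root∈roots L w))
      where
      one-root : length (roots L) ≡ 1
      one-root = sym (+-cancelˡ-≡ (length T) _ _ (trans tight (sym (edges+roots L))))

module CycleMatroid (G : Graph) (_≟_ : DecidableEquality (V G))
                    {vs : List (V G)} (vs-unique : Unique vs) (vs-complete : ∀ v → v ∈ vs)
                    (simple : Simple (edges G)) where

  open Components _≟_ vs-unique vs-complete
  open SpanningForest

  independent-labelling : ∀ {F} → Independent G F → Labelling F
  independent-labelling (F⊆ , acyclic) = forest-labelling _ (Simple-resp-⊇ F⊆ simple) acyclic

  connected⇒rank : V G → (∀ u w → Connected (edges G) u w) →
                   ∃ λ r → CycleMatroidRank G r × r + 1 ≡ length vs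
  connected⇒rank v connected = length tree , ((tree , (forest⊆ S , acyclic S) , refl) , maximal) , tight
    where
    S = spanning-forest (edges G)
    tree = forest S
    tight : length tree + 1 ≡ length vs
    tight = connected⇒edges+1≡vertices (labelling S) v λ u w → connects S (connected u w)
    maximal : ∀ F → Independent G F → length F ≤ length tree
    maximal F ind = +-cancelʳ-≤ 1 (length F) (length tree)
      (subst (length F + 1 ≤_) (sym tight) (edges+1≤vertices (independent-labelling ind) v))

  rank⇒connected : ∀ {r} → CycleMatroidRank G r → r + 1 ≡ length vs → ∀ u w → Connected (edges G) u w
  rank⇒connected ((F , ind , |F|≡r) , _) tight u w =
    Connected-mono (proj₁ ind) (edges+1≡vertices⇒connected (independent-labelling ind) (trans (cong (_+ 1) |F|≡r) tight) u w)

avoid-two : ∀ {m} → 3 ≤ m → (x y : Fin m) → ∃ λ z → z ≢ x × z ≢ y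
avoid-two (s≤s (s≤s (s≤s _))) zero          zero          = suc zero , (λ ()) , (λ ())
avoid-two (s≤s (s≤s (s≤s _))) zero          (suc zero)    = suc (suc zero) , (λ ()) , (λ ())
avoid-two (s≤s (s≤s (s≤s _))) zero          (suc (suc _)) = suc zero , (λ ()) , (λ ())
avoid-two (s≤s (s≤s (s≤s _))) (suc zero)    zero          = suc (suc zero) , (λ ()) , (λ ())
avoid-two (s≤s (s≤s (s≤s _))) (suc (suc _)) zero          = suc zero , (λ ()) , (λ ())
avoid-two (s≤s (s≤s (s≤s _))) (suc _)       (suc _)       = zero , (λ ()) , (λ ())

≢-≢⇒≡ : ∀ {m} → m ≤ 2 → {x y z : Fin m} → x ≢ y → y ≢ z → x ≡ z
≢-≢⇒≡ {suc zero}       _ {zero}     {zero}     x≢y _   = ⊥-elim (x≢y refl)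
≢-≢⇒≡ {suc (suc zero)} _ {zero}     {zero}     x≢y _   = ⊥-elim (x≢y refl)
≢-≢⇒≡ {suc (suc zero)} _ {suc zero} {suc zero} x≢y _   = ⊥-elim (x≢y refl)
≢-≢⇒≡ {suc (suc zero)} _ {zero}     {suc zero} {zero}     _ _   = refl
≢-≢⇒≡ {suc (suc zero)} _ {suc zero} {zero}     {suc zero} _ _   = refl
≢-≢⇒≡ {suc (suc zero)} _ {zero}     {suc zero} {suc zero} _ y≢z = ⊥-elim (y≢z refl)
≢-≢⇒≡ {suc (suc zero)} _ {suc zero} {zero}     {zero}     _ y≢z = ⊥-elim (y≢z refl)
≢-≢⇒≡ {suc (suc (suc _))} (s≤s (s≤s ()))

inhabited : ∀ {r m} → r + 1 ≡ 2 * m → Fin m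
inhabited {r} {zero} r+1≡0 with trans (+-comm 1 r) r+1≡0
... | ()
inhabited {m = suc _} _ = zero

module Bipartite (D : Digraph) where

  E : List (V (B D) × V (B D))
  E = edges (B D)

  _≟_ : DecidableEquality (V (B D))
  _≟_ = ≡-dec Fin._≟_ Fin._≟_

  vertices : List (V (B D))
  vertices = map inj₁ (allFin (n D)) ++ map inj₂ (allFin (n D))

  vertices-complete : ∀ v → v ∈ vertices
  vertices-complete (inj₁ x) = ∈-++⁺ˡ (∈-map⁺ inj₁ (∈-allFin x))
  vertices-complete (inj₂ x) = ∈-++⁺ʳ (map inj₁ (allFin (n D))) (∈-map⁺ inj₂ (∈-allFin x))

  vertices-unique : Unique vertices
  vertices-unique = Unique.++⁺ (Unique.map⁺ (λ { refl → refl }) (Unique.allFin⁺ (n D)))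
                               (Unique.map⁺ (λ { refl → refl }) (Unique.allFin⁺ (n D)))
                               disjoint
    where
    disjoint : ∀ {v} → ¬ (v ∈ map inj₁ (allFin (n D)) × v ∈ map inj₂ (allFin (n D)))
    disjoint (v∈₁ , v∈₂) with ∈-map⁻ inj₁ v∈₁ | ∈-map⁻ inj₂ v∈₂
    ... | _ , _ , refl | _ , _ , ()

  vertices-length : length vertices ≡ 2 * n D
  vertices-length = begin
    length (map inj₁ (allFin (n D)) ++ map inj₂ (allFin (n D)))
      ≡⟨ length-++ (map inj₁ (allFin (n D))) ⟩
    length (map inj₁ (allFin (n D))) + length (map inj₂ (allFin (n D)))
      ≡⟨ cong₂ _+_ (length-map inj₁ (allFin (n D))) (length-map inj₂ (allFin (n D))) ⟩
    length (allFin (n D)) + length (allFin (n D))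
      ≡⟨ cong₂ _+_ (length-tabulate {n = n D} (λ x → x)) (length-tabulate {n = n D} (λ x → x)) ⟩
    n D + n D
      ≡⟨ cong (n D +_) (sym (+-identityʳ (n D))) ⟩
    2 * n D ∎
    where open ≡-Reasoning

  private
    is-arc? : (p : Fin (n D) × Fin (n D)) → Dec (T (arc D (proj₁ p) (proj₂ p)))
    is-arc? (x , y) = T? (arc D x y)

  arc⇒edge : ∀ {x y} → Arc D x y → (inj₁ x , inj₂ y) ∈ E
  arc⇒edge {x} {y} xy = ∈-map⁺ _ (∈-filter⁺ is-arc? (∈-cartesianProduct⁺ (∈-allFin x) (∈-allFin y))
                                               (Equivalence.from T-≡ xy))

  edge⇒arc : ∀ {u w} → (u , w) ∈ E → ∃₂ λ x y → u ≡ inj₁ x × w ≡ inj₂ y × Arc D x y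
  edge⇒arc uw with ∈-map⁻ _ uw
  ... | (x , y) , xy∈ , refl =
    x , y , refl , refl , Equivalence.to T-≡ (proj₂ (∈-filter⁻ is-arc? {xs = cartesianProduct (allFin (n D)) (allFin (n D))} xy∈))

  arc-irreflexive : ∀ {x y} → Arc D x y → x ≢ y
  arc-irreflexive {x} xy refl with trans (sym xy) (loopless D x)
  ... | ()

  simple : Simple E
  simple = Unique.map⁺ (λ { refl → refl })
             (Unique.filter⁺ is-arc? (Unique.cartesianProduct⁺ (Unique.allFin⁺ (n D)) (Unique.allFin⁺ (n D))))
         , reversed-absent
    where
    reversed-absent : ∀ {u w} → (u , w) ∈ E → (w , u) ∉ E
    reversed-absent uw wu with edge⇒arc uw | edge⇒arc wu
    ... | _ , _ , refl , refl , _ | _ , _ , () , _ , _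

  -- A walk that must continue with a forward arc sits at the tail of that arc, in V′.
  side : Bool → Fin (n D) → V (B D)
  side true  = inj₁
  side false = inj₂

  walk⇒connected : ∀ {s e x y as} → AW D s e x y as → Connected E (side s x) (side e y)
  walk⇒connected nil          = ε
  walk⇒connected (fwd xz walk) = inj₁ (arc⇒edge xz) ◅ walk⇒connected walk
  walk⇒connected (bwd zx walk) = inj₂ (arc⇒edge zx) ◅ walk⇒connected walk

  antistrong⇒connected : Antistrong D → ∀ u w → Connected E u w
  antistrong⇒connected (3≤n , trail) u w = to-tail u ◅◅ Connected-sym (to-tail w)
    where
    hub : Fin (n D)
    hub = reduce u

    reach : ∀ x y → x ≢ y → Connected E (inj₁ x) (inj₂ y)
    reach x y x≢y = walk⇒connected (proj₁ (proj₂ (trail x y x≢y)))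

    to-tail : ∀ v → Connected E v (inj₁ hub)
    to-tail (inj₁ x) with avoid-two 3≤n x hub
    ... | z , z≢x , z≢hub = reach x z (z≢x ∘ sym) ◅◅ Connected-sym (reach hub z (z≢hub ∘ sym))
    to-tail (inj₂ y) with avoid-two 3≤n y y
    ... | z , z≢y , _ = Connected-sym (reach z y z≢y) ◅◅ to-tail (inj₁ z)

  -- Each arc is recorded with its two ends on the path, so distinct vertices give distinct arcs.
  path⇒walk : ∀ {s e x y vs} → Path E (side s x) (side e y) vs → Unique vs →
              ∃ λ as → AW D s e x y as × Unique as ×
                       (∀ {t h} → (t , h) ∈ as → inj₁ t ∈ vs × inj₂ h ∈ vs)
  path⇒walk {true}  {true}  [] _ = [] , nil , [] , λ ()
  path⇒walk {false} {false} [] _ = [] , nil , [] , λ ()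
  path⇒walk {true}  (inj₁ xz ∷ p) (x∉ ∷ U) with edge⇒arc xz
  ... | _ , z , refl , refl , arc-xz with path⇒walk {false} p U
  ...   | as , walk , as-unique , on =
    (_ , z) ∷ as , fwd arc-xz walk , ¬Any⇒All¬ as (All¬⇒¬Any x∉ ∘ proj₁ ∘ on) ∷ as-unique ,
    λ { (here refl) → here refl , there (Path-head∈ p) ; (there th) → there (proj₁ (on th)) , there (proj₂ (on th)) }
  path⇒walk {false} (inj₂ zx ∷ p) (x∉ ∷ U) with edge⇒arc zx
  ... | z , _ , refl , refl , arc-zx with path⇒walk {true} p U
  ...   | as , walk , as-unique , on =
    (z , _) ∷ as , bwd arc-zx walk , ¬Any⇒All¬ as (All¬⇒¬Any x∉ ∘ proj₂ ∘ on) ∷ as-unique ,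
    λ { (here refl) → there (Path-head∈ p) , here refl ; (there th) → there (proj₁ (on th)) , there (proj₂ (on th)) }
  path⇒walk {true}  (inj₂ zx ∷ _) _ with edge⇒arc zx
  ... | _ , _ , _ , () , _
  path⇒walk {false} (inj₁ xz ∷ _) _ with edge⇒arc xz
  ... | _ , _ , () , _ , _

  connected⇒trail : ∀ {x y} → Connected E (inj₁ x) (inj₂ y) → ForwardAntidirectedTrail D x y
  connected⇒trail c with Connected⇒Path _≟_ c
  ... | _ , p , U with path⇒walk {true} {false} p U
  ... | as , walk , as-unique , _ = as , walk , as-unique

  small⇒disconnected : n D ≤ 2 → ∀ x → ¬ Connected E (inj₁ x) (inj₂ x)
  small⇒disconnected n≤2 x c = preserved c refl refl
    where
    -- For n ≤ 2 loops are the only arcs that could leave this set, and it misses x″.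
    Near : V (B D) → Set
    Near (inj₁ t) = t ≡ x
    Near (inj₂ h) = h ≢ x

    step-preserves : ∀ {u w} → Adj E u w → Near u → Near w
    step-preserves (inj₁ uw) with edge⇒arc uw
    ... | _ , _ , refl , refl , th = λ t≡x h≡x → arc-irreflexive th (trans t≡x (sym h≡x))
    step-preserves (inj₂ wu) with edge⇒arc wu
    ... | _ , _ , refl , refl , th = ≢-≢⇒≡ n≤2 (arc-irreflexive th)

    preserved : ∀ {u w} → Connected E u w → Near u → Near w
    preserved = fold (λ u w → Near u → Near w) (λ a k → k ∘ step-preserves a) (λ near → near)

  connected⇒3≤n : Fin (n D) → (∀ u w → Connected E u w) → 3 ≤ n D
  connected⇒3≤n x connected with 3 ≤? n D
  ... | yes 3≤n = 3≤n
  ... | no  3≰n = ⊥-elim (small⇒disconnected (s≤s⁻¹ (≰⇒> 3≰n)) x (connected _ _))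

theorem5p3 : (D : Digraph) →
    Antistrong D ⇔ (Σ ℕ λ r → CycleMatroidRank (B D) r × (r + 1 ≡ 2 * n D))
theorem5p3 D = mk⇔ to from
  where
  open Bipartite D
  open CycleMatroid (B D) _≟_ vertices-unique vertices-complete simple

  to : Antistrong D → Σ ℕ λ r → CycleMatroidRank (B D) r × (r + 1 ≡ 2 * n D)
  to antistrong@(3≤n , _) =
    let r , rank , tight = connected⇒rank (inj₁ (fromℕ< (≤-trans (s≤s z≤n) 3≤n)))
                                          (antistrong⇒connected antistrong)
    in  r , rank , trans tight vertices-length

  from : (Σ ℕ λ r → CycleMatroidRank (B D) r × (r + 1 ≡ 2 * n D)) → Antistrong D
  from (r , rank , r+1≡2n) =
    connected⇒3≤n (inhabited r+1≡2n) connected , λ x y _ → connected⇒trail (connected _ _)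
    where
    connected : ∀ u w → Connected E u w
    connected = rank⇒connected rank (trans r+1≡2n (sym vertices-length))
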